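{- Let $n>4$ be even and $\mathrm{D}_{2n}=\langle a,b\mid a^n=b^2=1,\ bab=a^{ -1}\rangle$. Then the Cayley graph $\mathrm{Cay}(\mathrm{D}_{2n},\{a,a^{ -1},b\})$ is normal but is not a CI-graph.
   Context: For a group $G$ and $S\subseteq G$ with $1\notin S$, $S=S^{ -1}$, $\mathrm{Cay}(G,S)$ is the graph with vertex set $G$ in which $g$ and $sg$ are adjacent for $g\in G$, $s\in S$. $R(g)$ is the permutation $x\mapsto xg$ of $G$; $\mathrm{Cay}(G,S)$ is normal if $\{R(g)\mid g\in G\}\trianglelefteq\mathrm{Aut}(\mathrm{Cay}(G,S))$. It is a CI-graph if whenever $\mathrm{Cay}(G,S)\cong\mathrm{Cay}(G,T)$ for some $T\subseteq G$ with $1\notin T$, there is $\alpha\in\mathrm{Aut}(G)$ with $S^\alpha=T$. -}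

module Defs where

open import Level using (0ℓ)
open import Data.Nat using (ℕ; NonZero; _∸_)
open import Data.Nat.DivMod using (_mod_)
open import Data.Fin using (Fin; toℕ)
open import Data.Bool using (Bool; true; false; not)
open import Data.Product using (Σ; _×_; _,_; ∃)
open import Data.Sum using (_⊎_)
open import Relation.Binary.PropositionalEquality using (_≡_)
open import Relation.Unary using (Pred; _∈_; _∉_)
open import Relation.Nullary using (¬_)
open import Function.Bundles using (_↔_; Inverse)

module CayleyNotions (G : Set) (_·_ : G → G → G) (ε : G) where

  Adj : Pred G 0ℓ → G → G → Set
  Adj S g h = Σ G λ s → s ∈ S × h ≡ s · g

  IsGraphIso : Pred G 0ℓ → Pred G 0ℓ → (G ↔ G) → Set
  IsGraphIso S T φ =
    ∀ g h → (Adj S g h → Adj T (Inverse.to φ g) (Inverse.to φ h))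
          × (Adj T (Inverse.to φ g) (Inverse.to φ h) → Adj S g h)

  CayIso : Pred G 0ℓ → Pred G 0ℓ → Set
  CayIso S T = Σ (G ↔ G) (IsGraphIso S T)

  IsGraphAut : Pred G 0ℓ → (G ↔ G) → Set
  IsGraphAut S φ = IsGraphIso S S φ

  R : G → G → G
  R g x = x · g

  -- Cay(G,S) normal: R(G) is normalised by every graph automorphism, i.e.
  -- φ R(g) φ⁻¹ ∈ R(G) for all φ ∈ Aut(Cay(G,S)), g ∈ G
  IsNormalCayley : Pred G 0ℓ → Set
  IsNormalCayley S =
    ∀ (φ : G ↔ G) → IsGraphAut S φ → ∀ g →
      Σ G λ g' → ∀ x → Inverse.to φ (R g (Inverse.from φ x)) ≡ R g' x

  IsGroupAut : (G ↔ G) → Set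
  IsGroupAut α = ∀ x y → Inverse.to α (x · y) ≡ Inverse.to α x · Inverse.to α y

  ImageEq : (G ↔ G) → Pred G 0ℓ → Pred G 0ℓ → Set
  ImageEq α S T =
    (∀ x → x ∈ S → Inverse.to α x ∈ T) ×
    (∀ y → y ∈ T → Σ G λ x → x ∈ S × Inverse.to α x ≡ y)

  IsCIGraph : Pred G 0ℓ → Set₁
  IsCIGraph S =
    ∀ (T : Pred G 0ℓ) → ε ∉ T → CayIso S T →
      Σ (G ↔ G) λ α → IsGroupAut α × ImageEq α S T

-- The dihedral group D_{2n}: the element (i , e) stands for a^i b^e
-- (i ∈ ℤ/n, e ∈ {0,1}); relations a^n = b^2 = 1, b a b = a⁻¹.

module Dihedral (n : ℕ) .{{_ : NonZero n}} where

  D : Set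
  D = Fin n × Bool

  _+ₙ_ : Fin n → Fin n → Fin n
  i +ₙ j = (toℕ i Data.Nat.+ toℕ j) mod n

  -ₙ_ : Fin n → Fin n
  -ₙ j = (n ∸ toℕ j) mod n

  -- a^i b^e · a^j b^f = a^(i ± j) b^(e+f)
  _·_ : D → D → D
  (i , false) · (j , f) = (i +ₙ j) , f
  (i , true)  · (j , f) = (i +ₙ (-ₙ j)) , not f

  e : D
  e = (0 mod n) , false

  a : D
  a = (1 mod n) , false

  a⁻¹ : D
  a⁻¹ = ((n ∸ 1) mod n) , false

  b : D
  b = (0 mod n) , true

  S : Pred D 0ℓ
  S x = x ≡ a ⊎ x ≡ a⁻¹ ⊎ x ≡ b

  open CayleyNotions D _·_ e public

-- Cay(D₂ₙ, {a, a⁻¹, b}) is the n-prism: two n-cycles of a-edges joined by the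
-- matching of b-edges. Since n > 4, the two a-neighbours of a vertex have no second common
-- neighbour, while an a-neighbour and the b-neighbour always have one. Hence every graph
-- automorphism f commutes with left multiplication by b and maps a-edges to a-edges, and
-- following the powers of a shows that f is x ↦ x·f(e) or x ↦ (b x b)·f(e). Both normalise
-- the right regular representation.
-- For even n, the parity π(aⁱbʲ) = i mod 2 is a homomorphism onto ℤ/2, and x ↦ b^π(x)·x is an
-- isomorphism from Cay(D₂ₙ, {a, a⁻¹, b}) onto Cay(D₂ₙ, {b, ab, a⁻¹b}). No automorphism of D₂ₙ
-- maps a into the latter set, which consists of involutions, whereas a² ≢ e.

module Submission where

open import Defs
open import Level using (0ℓ)
open import Data.Nat using (ℕ; parity; >-nonZero⁻¹; NonZero; zero; suc; _+_; _*_; _∸_; _%_; _<_; s≤s; z≤n)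
open import Data.Nat.Properties using (+-assoc; +-comm; m∸n+n≡m; n≤0⇒n≡0; <⇒≢; ≤-<-trans)
open import Data.Nat.DivMod
  using (_mod_; _/_; m%n<n; m%n≤m; m%n%n≡m%n; n%n≡0; m<n⇒m%n≡m; %-distribˡ-+; m≡m%n+[m/n]*n)
open import Data.Nat.Divisibility using (_∣_; divides)
open import Data.Parity using (Parity; 0ℙ; 1ℙ) renaming (_+_ to _⊕_; _*_ to _⊛_)
import Data.Parity.Properties as ℙ
open import Data.Fin using (Fin; toℕ)
open import Data.Fin.Properties using (toℕ-injective; toℕ<n; toℕ≤n; toℕ-fromℕ<)
open import Data.Bool using (true; false; not)
open import Data.Product using (_×_; _,_; Σ; proj₁; proj₂)
open import Data.Sum using (_⊎_; inj₁; inj₂)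
import Data.Sum as Sum
open import Algebra.Bundles using (AbelianGroup; Group)
open import Algebra.Structures using (IsAbelianGroup; IsGroup)
open import Algebra.Consequences.Propositional using (comm∧idˡ⇒id; comm∧invˡ⇒inv)
import Algebra.Properties.AbelianGroup as AbelianGroupProperties
import Algebra.Properties.Group as GroupProperties
open import Relation.Binary.PropositionalEquality
open import Relation.Nullary using (¬_)
open import Relation.Unary using (Pred; _∈_; _∉_)
open import Data.Empty using (⊥-elim)
open import Function.Bundles using (_↔_; Inverse; Injection; mk↔ₛ′)
open import Function.Properties.Inverse using (↔⇒↣)
open import Function using (_∘_; id)

module _ {G : Set} (_·_ : G → G → G) (ε : G) where
  open CayleyNotions G _·_ ε

  cayIso-fromLocal : ∀ {S T} (ψ : G ↔ G) →
    (∀ g s → s ∈ S → Σ G λ t → t ∈ T × Inverse.to ψ (s · g) ≡ t · Inverse.to ψ g) →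
    (∀ g t → t ∈ T → Σ G λ s → s ∈ S × Inverse.to ψ (s · g) ≡ t · Inverse.to ψ g) →
    CayIso S T
  cayIso-fromLocal {S} {T} ψ S→T T→S = ψ , λ g h → forward g h , backward g h
    where
    forward : ∀ g h → Adj S g h → Adj T (Inverse.to ψ g) (Inverse.to ψ h)
    forward g h (s , s∈S , h≡s·g) with S→T g s s∈S
    ... | t , t∈T , ψ[s·g]≡t·ψg = t , t∈T , trans (cong (Inverse.to ψ) h≡s·g) ψ[s·g]≡t·ψg
    backward : ∀ g h → Adj T (Inverse.to ψ g) (Inverse.to ψ h) → Adj S g h
    backward g h (t , t∈T , ψh≡t·ψg) with T→S g t t∈T
    ... | s , s∈S , ψ[s·g]≡t·ψg =
      s , s∈S , Injection.injective (↔⇒↣ ψ) (trans ψh≡t·ψg (sym ψ[s·g]≡t·ψg))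

parity-even : ∀ {n} → 2 ∣ n → parity n ≡ 0ℙ
parity-even (divides q refl) = trans (ℙ.*-homo-* q 2) (ℙ.*-zeroʳ (parity q))

parity-% : ∀ m n .{{_ : NonZero n}} → 2 ∣ n → parity (m % n) ≡ parity m
parity-% m n 2∣n = sym (begin
  parity m                                       ≡⟨ cong parity (m≡m%n+[m/n]*n m n) ⟩
  parity (m % n + m / n * n)                     ≡⟨ ℙ.+-homo-+ (m % n) (m / n * n) ⟩
  parity (m % n) ⊕ parity (m / n * n)            ≡⟨ cong (parity (m % n) ⊕_) (ℙ.*-homo-* (m / n) n) ⟩
  parity (m % n) ⊕ (parity (m / n) ⊛ parity n)   ≡⟨ cong (λ p → parity (m % n) ⊕ (parity (m / n) ⊛ p)) (parity-even 2∣n) ⟩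
  parity (m % n) ⊕ (parity (m / n) ⊛ 0ℙ)         ≡⟨ cong (parity (m % n) ⊕_) (ℙ.*-zeroʳ (parity (m / n))) ⟩
  parity (m % n) ⊕ 0ℙ                            ≡⟨ ℙ.+-identityʳ (parity (m % n)) ⟩
  parity (m % n)                                 ∎)
  where open ≡-Reasoning

module ModularArithmetic (n : ℕ) .{{_ : NonZero n}} where
  open Dihedral n using (_+ₙ_; -ₙ_)
  open ≡-Reasoning

  toℕ-mod : ∀ m → toℕ (m mod n) ≡ m % n
  toℕ-mod m = toℕ-fromℕ< (m%n<n m n)

  mod-cong : ∀ {m m′} → m % n ≡ m′ % n → m mod n ≡ m′ mod n
  mod-cong {m} {m′} eq = toℕ-injective (trans (toℕ-mod m) (trans eq (sym (toℕ-mod m′))))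

  toℕ-mod-inverse : ∀ (i : Fin n) → toℕ i mod n ≡ i
  toℕ-mod-inverse i = toℕ-injective (trans (toℕ-mod (toℕ i)) (m<n⇒m%n≡m (toℕ<n i)))

  toℕ-mod-absorbˡ : ∀ m k → (toℕ (m mod n) + k) mod n ≡ (m + k) mod n
  toℕ-mod-absorbˡ m k = mod-cong (begin
    (toℕ (m mod n) + k) % n           ≡⟨ cong (λ x → (x + k) % n) (toℕ-mod m) ⟩
    (m % n + k) % n                   ≡⟨ %-distribˡ-+ (m % n) k n ⟩
    (m % n % n + k % n) % n           ≡⟨ cong (λ x → (x + k % n) % n) (m%n%n≡m%n m n) ⟩
    (m % n + k % n) % n               ≡⟨ %-distribˡ-+ m k n ⟨
    (m + k) % n                       ∎)

  toℕ-mod-absorbʳ : ∀ k m → (k + toℕ (m mod n)) mod n ≡ (k + m) mod n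
  toℕ-mod-absorbʳ k m = begin
    (k + toℕ (m mod n)) mod n  ≡⟨ cong (_mod n) (+-comm k _) ⟩
    (toℕ (m mod n) + k) mod n  ≡⟨ toℕ-mod-absorbˡ m k ⟩
    (m + k) mod n              ≡⟨ cong (_mod n) (+-comm m k) ⟩
    (k + m) mod n              ∎

  0ₙ : Fin n
  0ₙ = 0 mod n

  0%n≡0 : 0 % n ≡ 0
  0%n≡0 = n≤0⇒n≡0 (m%n≤m 0 n)

  n-mod-n : n mod n ≡ 0ₙ
  n-mod-n = mod-cong (trans (n%n≡0 n) (sym 0%n≡0))

  +ₙ-assoc : ∀ i j k → (i +ₙ j) +ₙ k ≡ i +ₙ (j +ₙ k)
  +ₙ-assoc i j k = begin
    (toℕ ((toℕ i + toℕ j) mod n) + toℕ k) mod n  ≡⟨ toℕ-mod-absorbˡ (toℕ i + toℕ j) (toℕ k) ⟩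
    (toℕ i + toℕ j + toℕ k) mod n                ≡⟨ cong (_mod n) (+-assoc (toℕ i) (toℕ j) (toℕ k)) ⟩
    (toℕ i + (toℕ j + toℕ k)) mod n              ≡⟨ toℕ-mod-absorbʳ (toℕ i) (toℕ j + toℕ k) ⟨
    (toℕ i + toℕ ((toℕ j + toℕ k) mod n)) mod n  ∎

  +ₙ-comm : ∀ i j → i +ₙ j ≡ j +ₙ i
  +ₙ-comm i j = cong (_mod n) (+-comm (toℕ i) (toℕ j))

  +ₙ-identityˡ : ∀ i → 0ₙ +ₙ i ≡ i
  +ₙ-identityˡ i = trans (toℕ-mod-absorbˡ 0 (toℕ i)) (toℕ-mod-inverse i)

  -ₙ-inverseˡ : ∀ i → (-ₙ i) +ₙ i ≡ 0ₙ
  -ₙ-inverseˡ i = begin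
    (toℕ ((n ∸ toℕ i) mod n) + toℕ i) mod n  ≡⟨ toℕ-mod-absorbˡ (n ∸ toℕ i) (toℕ i) ⟩
    (n ∸ toℕ i + toℕ i) mod n                ≡⟨ cong (_mod n) (m∸n+n≡m (toℕ≤n i)) ⟩
    n mod n                                  ≡⟨ n-mod-n ⟩
    0ₙ                                       ∎

  +ₙ-isAbelianGroup : IsAbelianGroup _≡_ _+ₙ_ 0ₙ -ₙ_
  +ₙ-isAbelianGroup = record
    { isGroup = record
      { isMonoid = record
        { isSemigroup = record
          { isMagma = record { isEquivalence = isEquivalence ; ∙-cong = cong₂ _+ₙ_ }
          ; assoc = +ₙ-assoc
          }
        ; identity = comm∧idˡ⇒id +ₙ-comm +ₙ-identityˡ
        }
      ; inverse = comm∧invˡ⇒inv +ₙ-comm -ₙ-inverseˡ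
      ; ⁻¹-cong = cong -ₙ_
      }
    ; comm = +ₙ-comm
    }

  ℤₙ : AbelianGroup 0ℓ 0ℓ
  ℤₙ = record { isAbelianGroup = +ₙ-isAbelianGroup }

  module _ (2∣n : 2 ∣ n) where

    parity-mod : ∀ m → parity (toℕ (m mod n)) ≡ parity m
    parity-mod m = trans (cong parity (toℕ-mod m)) (parity-% m n 2∣n)

    parity-+ₙ : ∀ i j → parity (toℕ (i +ₙ j)) ≡ parity (toℕ i) ⊕ parity (toℕ j)
    parity-+ₙ i j = trans (parity-mod (toℕ i + toℕ j)) (ℙ.+-homo-+ (toℕ i) (toℕ j))

    parity-negₙ : ∀ i → parity (toℕ (-ₙ i)) ≡ parity (toℕ i)
    parity-negₙ i = ℙ.+-cancelʳ-≡ (parity (toℕ i)) _ _ (begin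
      parity (toℕ (-ₙ i)) ⊕ parity (toℕ i)   ≡⟨ cong (_⊕ parity (toℕ i)) (parity-mod (n ∸ toℕ i)) ⟩
      parity (n ∸ toℕ i) ⊕ parity (toℕ i)    ≡⟨ ℙ.+-homo-+ (n ∸ toℕ i) (toℕ i) ⟨
      parity (n ∸ toℕ i + toℕ i)             ≡⟨ cong parity (m∸n+n≡m (toℕ≤n i)) ⟩
      parity n                               ≡⟨ parity-even 2∣n ⟩
      0ℙ                                     ≡⟨ ℙ.p+p≡0ℙ (parity (toℕ i)) ⟨
      parity (toℕ i) ⊕ parity (toℕ i)        ∎)

  open IsAbelianGroup +ₙ-isAbelianGroup public
    using () renaming (identityʳ to +ₙ-identityʳ; inverseʳ to -ₙ-inverseʳ)
  open AbelianGroupProperties ℤₙ public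
    using () renaming (⁻¹-involutive to -ₙ-involutive; ⁻¹-∙-comm to -ₙ-+ₙ-comm; ε⁻¹≈ε to -ₙ0ₙ≡0ₙ)

module DihedralGroup (n : ℕ) .{{_ : NonZero n}} where
  open Dihedral n
  open ModularArithmetic n
  open ≡-Reasoning

  inv : D → D
  inv (i , false) = -ₙ i , false
  inv (i , true)  = i , true

  -ₙ-+ₙ-sub : ∀ j k → -ₙ (j +ₙ (-ₙ k)) ≡ (-ₙ j) +ₙ k
  -ₙ-+ₙ-sub j k = begin
    -ₙ (j +ₙ (-ₙ k))          ≡⟨ -ₙ-+ₙ-comm j (-ₙ k) ⟨
    (-ₙ j) +ₙ (-ₙ (-ₙ k))     ≡⟨ cong ((-ₙ j) +ₙ_) (-ₙ-involutive k) ⟩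
    (-ₙ j) +ₙ k               ∎

  ·-assoc : ∀ x y z → (x · y) · z ≡ x · (y · z)
  ·-assoc (i , false) (j , false) (k , f) = cong (_, f) (+ₙ-assoc i j k)
  ·-assoc (i , false) (j , true)  (k , f) = cong (_, not f) (+ₙ-assoc i j (-ₙ k))
  ·-assoc (i , true)  (j , false) (k , f) = cong (_, not f)
    (trans (+ₙ-assoc i (-ₙ j) (-ₙ k)) (cong (i +ₙ_) (-ₙ-+ₙ-comm j k)))
  ·-assoc (i , true)  (j , true)  (k , false) = cong (_, false)
    (trans (+ₙ-assoc i (-ₙ j) k) (cong (i +ₙ_) (sym (-ₙ-+ₙ-sub j k))))
  ·-assoc (i , true)  (j , true)  (k , true) = cong (_, true)
    (trans (+ₙ-assoc i (-ₙ j) k) (cong (i +ₙ_) (sym (-ₙ-+ₙ-sub j k))))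

  ·-identityˡ : ∀ x → e · x ≡ x
  ·-identityˡ (j , f) = cong (_, f) (+ₙ-identityˡ j)

  ·-identityʳ : ∀ x → x · e ≡ x
  ·-identityʳ (i , false) = cong (_, false) (+ₙ-identityʳ i)
  ·-identityʳ (i , true)  = cong (_, true) (trans (cong (i +ₙ_) -ₙ0ₙ≡0ₙ) (+ₙ-identityʳ i))

  inv-inverseˡ : ∀ x → inv x · x ≡ e
  inv-inverseˡ (i , false) = cong (_, false) (-ₙ-inverseˡ i)
  inv-inverseˡ (i , true)  = cong (_, false) (-ₙ-inverseʳ i)

  inv-inverseʳ : ∀ x → x · inv x ≡ e
  inv-inverseʳ (i , false) = cong (_, false) (-ₙ-inverseʳ i)
  inv-inverseʳ (i , true)  = cong (_, false) (-ₙ-inverseʳ i)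

  D-isGroup : IsGroup _≡_ _·_ e inv
  D-isGroup = record
    { isMonoid = record
      { isSemigroup = record
        { isMagma = record { isEquivalence = isEquivalence ; ∙-cong = cong₂ _·_ }
        ; assoc = ·-assoc
        }
      ; identity = ·-identityˡ , ·-identityʳ
      }
    ; inverse = inv-inverseˡ , inv-inverseʳ
    ; ⁻¹-cong = cong inv
    }

  D-group : Group 0ℓ 0ℓ
  D-group = record { isGroup = D-isGroup }

  open GroupProperties D-group public
    using (∙-cancelˡ; ∙-cancelʳ; inverseˡ-unique; x≈z//y) renaming (⁻¹-involutive to inv-involutive)

  ·-cancel-inverse : ∀ s t → s · t ≡ e → ∀ x → s · (t · x) ≡ x
  ·-cancel-inverse s t s·t≡e x = begin
    s · (t · x)   ≡⟨ ·-assoc s t x ⟨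
    (s · t) · x   ≡⟨ cong (_· x) s·t≡e ⟩
    e · x         ≡⟨ ·-identityˡ x ⟩
    x             ∎

  ·-fixes⇒≡e : ∀ s x → s · x ≡ x → s ≡ e
  ·-fixes⇒≡e s x eq = ∙-cancelʳ x s e (trans eq (sym (·-identityˡ x)))

  ·-cancel-twoʳ : ∀ s t s′ t′ x → s · (t · x) ≡ s′ · (t′ · x) → s · t ≡ s′ · t′
  ·-cancel-twoʳ s t s′ t′ x eq = ∙-cancelʳ x (s · t) (s′ · t′)
    (trans (·-assoc s t x) (trans eq (sym (·-assoc s′ t′ x))))

  reflection≢e : ∀ {i} → (i , true) ≢ e
  reflection≢e ()

  groupAut-e : (α : D ↔ D) → IsGroupAut α → Inverse.to α e ≡ e
  groupAut-e α α-homo = ·-fixes⇒≡e (Inverse.to α e) (Inverse.to α e)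
    (trans (sym (α-homo e e)) (cong (Inverse.to α) (·-identityˡ e)))

  affine-normalises-R : (φ : D ↔ D) (h : D → D) → (∀ x y → h (x · y) ≡ h x · h y) →
    ∀ c → (∀ y → Inverse.to φ y ≡ h y · c) →
    ∀ g → Σ D λ g′ → ∀ x → Inverse.to φ (R g (Inverse.from φ x)) ≡ R g′ x
  affine-normalises-R φ h h-homo c f≡h·c g = (inv c · h g) · c , λ x → begin
    f (f⁻¹ x · g)                  ≡⟨ f≡h·c (f⁻¹ x · g) ⟩
    h (f⁻¹ x · g) · c              ≡⟨ cong (_· c) (h-homo (f⁻¹ x) g) ⟩
    (h (f⁻¹ x) · h g) · c          ≡⟨ cong (λ z → (z · h g) · c) (h[f⁻¹x]≡x·c⁻¹ x) ⟩
    ((x · inv c) · h g) · c        ≡⟨ cong (_· c) (·-assoc x (inv c) (h g)) ⟩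
    (x · (inv c · h g)) · c        ≡⟨ ·-assoc x (inv c · h g) c ⟩
    x · ((inv c · h g) · c)        ∎
    where
    open Inverse φ using () renaming (to to f; from to f⁻¹; strictlyInverseˡ to f∘f⁻¹)
    h[f⁻¹x]≡x·c⁻¹ : ∀ x → h (f⁻¹ x) ≡ x · inv c
    h[f⁻¹x]≡x·c⁻¹ x = x≈z//y (h (f⁻¹ x)) c x (trans (sym (f≡h·c (f⁻¹ x))) (f∘f⁻¹ x))

  a^ : ℕ → D
  a^ k = k mod n , false

  a^-+ : ∀ k m → a^ k · a^ m ≡ a^ (k + m)
  a^-+ k m = cong (_, false) (begin
    (toℕ (k mod n) + toℕ (m mod n)) mod n  ≡⟨ toℕ-mod-absorbˡ k (toℕ (m mod n)) ⟩
    (k + toℕ (m mod n)) mod n              ≡⟨ toℕ-mod-absorbʳ k m ⟩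
    (k + m) mod n                          ∎)

  a^-injective-mod : ∀ {k m} → a^ k ≡ a^ m → k % n ≡ m % n
  a^-injective-mod {k} {m} eq = trans (sym (toℕ-mod k)) (trans (cong (toℕ ∘ proj₁) eq) (toℕ-mod m))

  a^-≢e : ∀ {k} → 0 < k → k < n → a^ k ≢ e
  a^-≢e {k} 0<k k<n eq = <⇒≢ 0<k (sym (begin
    k          ≡⟨ m<n⇒m%n≡m k<n ⟨
    k % n      ≡⟨ a^-injective-mod eq ⟩
    0 % n      ≡⟨ 0%n≡0 ⟩
    0          ∎))

  rotation≡a^ : ∀ i → (i , false) ≡ a^ (toℕ i)
  rotation≡a^ i = cong (_, false) (sym (toℕ-mod-inverse i))

  reflection≡b·rotation : ∀ i → (i , true) ≡ b · (-ₙ i , false)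
  reflection≡b·rotation i = cong (_, true) (sym (trans (+ₙ-identityˡ (-ₙ (-ₙ i))) (-ₙ-involutive i)))

  reflection-involutive : ∀ i → (i , true) · (i , true) ≡ e
  reflection-involutive i = inv-inverseʳ (i , true)

  b·rotation : ∀ i → b · (i , false) ≡ inv (i , false) · b
  b·rotation i = cong (_, true) (begin
    0ₙ +ₙ (-ₙ i)          ≡⟨ +ₙ-identityˡ (-ₙ i) ⟩
    -ₙ i                  ≡⟨ +ₙ-identityʳ (-ₙ i) ⟨
    (-ₙ i) +ₙ 0ₙ          ∎)

  a⁻¹·a≡e : a⁻¹ · a ≡ e
  a⁻¹·a≡e = begin
    a^ (n ∸ 1) · a^ 1   ≡⟨ a^-+ (n ∸ 1) 1 ⟩
    a^ (n ∸ 1 + 1)      ≡⟨ cong a^ (m∸n+n≡m (>-nonZero⁻¹ n)) ⟩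
    a^ n                ≡⟨ cong (_, false) n-mod-n ⟩
    e                   ∎

  a⁻¹≡inv-a : a⁻¹ ≡ inv a
  a⁻¹≡inv-a = inverseˡ-unique a⁻¹ a a⁻¹·a≡e

  a·a⁻¹≡e : a · a⁻¹ ≡ e
  a·a⁻¹≡e = trans (cong (a ·_) a⁻¹≡inv-a) (inv-inverseʳ a)

  b·b≡e : b · b ≡ e
  b·b≡e = reflection-involutive 0ₙ

  b·a≡a⁻¹·b : b · a ≡ a⁻¹ · b
  b·a≡a⁻¹·b = trans (b·rotation (1 mod n)) (cong (_· b) (sym a⁻¹≡inv-a))

  b·a⁻¹≡a·b : b · a⁻¹ ≡ a · b
  b·a⁻¹≡a·b = trans (b·rotation ((n ∸ 1) mod n)) (cong (_· b) (trans (cong inv a⁻¹≡inv-a) (inv-involutive a)))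

  σ : D → D
  σ x = b · (x · b)

  σ-homo : ∀ x y → σ (x · y) ≡ σ x · σ y
  σ-homo x y = sym (begin
    (b · (x · b)) · (b · (y · b))   ≡⟨ ·-assoc b (x · b) _ ⟩
    b · ((x · b) · (b · (y · b)))   ≡⟨ cong (b ·_) (·-assoc x b _) ⟩
    b · (x · (b · (b · (y · b))))   ≡⟨ cong (λ z → b · (x · z)) (·-cancel-inverse b b b·b≡e (y · b)) ⟩
    b · (x · (y · b))               ≡⟨ cong (b ·_) (·-assoc x y b) ⟨
    b · ((x · y) · b)               ∎)

  σ-involutive : ∀ x → σ (σ x) ≡ x
  σ-involutive x = begin
    b · ((b · (x · b)) · b)    ≡⟨ cong (b ·_) (·-assoc b (x · b) b) ⟩
    b · (b · ((x · b) · b))    ≡⟨ ·-cancel-inverse b b b·b≡e ((x · b) · b) ⟩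
    (x · b) · b                ≡⟨ ·-assoc x b b ⟩
    x · (b · b)                ≡⟨ cong (x ·_) b·b≡e ⟩
    x · e                      ≡⟨ ·-identityʳ x ⟩
    x                          ∎

  σ-e : σ e ≡ e
  σ-e = trans (cong (b ·_) (·-identityˡ b)) b·b≡e

  σ-b : σ b ≡ b
  σ-b = trans (cong (b ·_) b·b≡e) (·-identityʳ b)

  σ-a : σ a ≡ a⁻¹
  σ-a = begin
    b · (a · b)      ≡⟨ ·-assoc b a b ⟨
    (b · a) · b      ≡⟨ cong (_· b) b·a≡a⁻¹·b ⟩
    (a⁻¹ · b) · b    ≡⟨ ·-assoc a⁻¹ b b ⟩
    a⁻¹ · (b · b)    ≡⟨ cong (a⁻¹ ·_) b·b≡e ⟩
    a⁻¹ · e          ≡⟨ ·-identityʳ a⁻¹ ⟩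
    a⁻¹              ∎

module ParityTwist (n : ℕ) .{{_ : NonZero n}} (2∣n : 2 ∣ n) where
  open Dihedral n
  open ModularArithmetic n
  open DihedralGroup n
  open ≡-Reasoning

  π : D → Parity
  π (i , _) = parity (toℕ i)

  π-homo : ∀ x y → π (x · y) ≡ π x ⊕ π y
  π-homo (i , false) (j , _) = parity-+ₙ 2∣n i j
  π-homo (i , true)  (j , _) = trans (parity-+ₙ 2∣n i (-ₙ j)) (cong (parity (toℕ i) ⊕_) (parity-negₙ 2∣n j))

  π-b : π b ≡ 0ℙ
  π-b = parity-mod 2∣n 0

  π-a : π a ≡ 1ℙ
  π-a = parity-mod 2∣n 1

  π-a⁻¹ : π a⁻¹ ≡ 1ℙ
  π-a⁻¹ = ℙ.+-cancelʳ-≡ 1ℙ (π a⁻¹) 1ℙ (begin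
    π a⁻¹ ⊕ 1ℙ       ≡⟨ cong (π a⁻¹ ⊕_) π-a ⟨
    π a⁻¹ ⊕ π a      ≡⟨ π-homo a⁻¹ a ⟨
    π (a⁻¹ · a)      ≡⟨ cong π a⁻¹·a≡e ⟩
    π e              ≡⟨ π-b ⟩
    0ℙ               ∎)

  b^ : Parity → D
  b^ 0ℙ = e
  b^ 1ℙ = b

  π-b^ : ∀ p → π (b^ p) ≡ 0ℙ
  π-b^ 0ℙ = π-b
  π-b^ 1ℙ = π-b

  b^-involutive : ∀ p x → b^ p · (b^ p · x) ≡ x
  b^-involutive 0ℙ x = trans (·-identityˡ (e · x)) (·-identityˡ x)
  b^-involutive 1ℙ x = ·-cancel-inverse b b b·b≡e x

  ψ : D → D
  ψ x = b^ (π x) · x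

  ψ-involutive : ∀ x → ψ (ψ x) ≡ x
  ψ-involutive x = begin
    b^ (π (b^ (π x) · x)) · (b^ (π x) · x)   ≡⟨ cong (λ p → b^ p · (b^ (π x) · x)) π[b^·x]≡πx ⟩
    b^ (π x) · (b^ (π x) · x)                ≡⟨ b^-involutive (π x) x ⟩
    x                                        ∎
    where
    π[b^·x]≡πx : π (b^ (π x) · x) ≡ π x
    π[b^·x]≡πx = trans (π-homo (b^ (π x)) x) (cong (_⊕ π x) (π-b^ (π x)))

  ψ↔ : D ↔ D
  ψ↔ = mk↔ₛ′ ψ ψ ψ-involutive ψ-involutive

  ψ-b : ∀ x → ψ (b · x) ≡ b · ψ x
  ψ-b x = trans (cong (λ p → b^ p · (b · x)) (trans (π-homo b x) (cong (_⊕ π x) π-b))) (b^-b (π x))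
    where
    b^-b : ∀ p → b^ p · (b · x) ≡ b · (b^ p · x)
    b^-b 0ℙ = trans (·-identityˡ (b · x)) (cong (b ·_) (sym (·-identityˡ x)))
    b^-b 1ℙ = refl

  twist : Parity → D → D
  twist 0ℙ s = b · s
  twist 1ℙ s = s · b

  ψ-odd : ∀ s x → π s ≡ 1ℙ → ψ (s · x) ≡ twist (π x) s · ψ x
  ψ-odd s x πs≡1ℙ = trans (cong (λ p → b^ p · (s · x)) (trans (π-homo s x) (cong (_⊕ π x) πs≡1ℙ))) (b^-twist (π x))
    where
    b^-twist : ∀ p → b^ (1ℙ ⊕ p) · (s · x) ≡ twist p s · (b^ p · x)
    b^-twist 0ℙ = begin
      b · (s · x)         ≡⟨ ·-assoc b s x ⟨
      (b · s) · x         ≡⟨ cong ((b · s) ·_) (·-identityˡ x) ⟨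
      (b · s) · (e · x)   ∎
    b^-twist 1ℙ = begin
      e · (s · x)         ≡⟨ ·-identityˡ (s · x) ⟩
      s · x               ≡⟨ cong (s ·_) (b^-involutive 1ℙ x) ⟨
      s · (b · (b · x))   ≡⟨ ·-assoc s b (b · x) ⟨
      (s · b) · (b · x)   ∎

  T : Pred D 0ℓ
  T y = y ≡ b ⊎ y ≡ a · b ⊎ y ≡ a⁻¹ · b

  twist-cases : ∀ p → (twist p a ≡ a⁻¹ · b × twist p a⁻¹ ≡ a · b)
                    ⊎ (twist p a ≡ a · b × twist p a⁻¹ ≡ a⁻¹ · b)
  twist-cases 0ℙ = inj₁ (b·a≡a⁻¹·b , b·a⁻¹≡a·b)
  twist-cases 1ℙ = inj₂ (refl , refl)

  ψ-odd-step : ∀ g s {t} → π s ≡ 1ℙ → twist (π g) s ≡ t → ψ (s · g) ≡ t · ψ g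
  ψ-odd-step g s πs≡1ℙ twist≡t = trans (ψ-odd s g πs≡1ℙ) (cong (_· ψ g) twist≡t)

  ψ-S→T : ∀ g s → s ∈ S → Σ D λ t → t ∈ T × ψ (s · g) ≡ t · ψ g
  ψ-S→T g s s∈S with twist-cases (π g) | s∈S
  ... | _               | inj₂ (inj₂ refl) = b , inj₁ refl , ψ-b g
  ... | inj₁ (ta , _)   | inj₁ refl        = a⁻¹ · b , inj₂ (inj₂ refl) , ψ-odd-step g a π-a ta
  ... | inj₁ (_ , ta⁻¹) | inj₂ (inj₁ refl) = a · b , inj₂ (inj₁ refl) , ψ-odd-step g a⁻¹ π-a⁻¹ ta⁻¹
  ... | inj₂ (ta , _)   | inj₁ refl        = a · b , inj₂ (inj₁ refl) , ψ-odd-step g a π-a ta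
  ... | inj₂ (_ , ta⁻¹) | inj₂ (inj₁ refl) = a⁻¹ · b , inj₂ (inj₂ refl) , ψ-odd-step g a⁻¹ π-a⁻¹ ta⁻¹

  ψ-T→S : ∀ g t → t ∈ T → Σ D λ s → s ∈ S × ψ (s · g) ≡ t · ψ g
  ψ-T→S g t t∈T with twist-cases (π g) | t∈T
  ... | _               | inj₁ refl        = b , inj₂ (inj₂ refl) , ψ-b g
  ... | inj₁ (_ , ta⁻¹) | inj₂ (inj₁ refl) = a⁻¹ , inj₂ (inj₁ refl) , ψ-odd-step g a⁻¹ π-a⁻¹ ta⁻¹
  ... | inj₁ (ta , _)   | inj₂ (inj₂ refl) = a , inj₁ refl , ψ-odd-step g a π-a ta
  ... | inj₂ (ta , _)   | inj₂ (inj₁ refl) = a , inj₁ refl , ψ-odd-step g a π-a ta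
  ... | inj₂ (_ , ta⁻¹) | inj₂ (inj₂ refl) = a⁻¹ , inj₂ (inj₁ refl) , ψ-odd-step g a⁻¹ π-a⁻¹ ta⁻¹

  S≅T : CayIso S T
  S≅T = cayIso-fromLocal _·_ e ψ↔ ψ-S→T ψ-T→S

  e∉T : e ∉ T
  e∉T (inj₁ ())
  e∉T (inj₂ (inj₁ ()))
  e∉T (inj₂ (inj₂ ()))

  T-involutive : ∀ y → y ∈ T → y · y ≡ e
  T-involutive _ (inj₁ refl)        = reflection-involutive _
  T-involutive _ (inj₂ (inj₁ refl)) = reflection-involutive _
  T-involutive _ (inj₂ (inj₂ refl)) = reflection-involutive _

module PrismGraph (n : ℕ) .{{_ : NonZero n}} (4<n : 4 < n) where
  open Dihedral n
  open DihedralGroup n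
  open ≡-Reasoning

  a·a≢e : a · a ≢ e
  a·a≢e eq = a^-≢e {2} (s≤s z≤n) (≤-<-trans (s≤s (s≤s z≤n)) 4<n) (trans (sym (a^-+ 1 1)) eq)

  a⁴≢e : (a · a) · (a · a) ≢ e
  a⁴≢e eq = a^-≢e {4} (s≤s z≤n) 4<n (begin
    a^ 4                ≡⟨ a^-+ 2 2 ⟨
    a^ 2 · a^ 2         ≡⟨ cong₂ _·_ (a^-+ 1 1) (a^-+ 1 1) ⟨
    (a · a) · (a · a)   ≡⟨ eq ⟩
    e                   ∎)

  a≢a⁻¹ : a ≢ a⁻¹
  a≢a⁻¹ eq = a·a≢e (trans (cong (a ·_) eq) a·a⁻¹≡e)

  module _ (F : D → D) (F-injective : ∀ {x y} → F x ≡ F y → x ≡ y)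
           (F-b : ∀ x → F (b · x) ≡ b · F x)
           (F-a : ∀ x → F (a · x) ≡ a · F x ⊎ F (a · x) ≡ a⁻¹ · F x)
           (F-a-e : F a ≡ a · F e) where

    private
      c : D
      c = F e

    -- Induction on pairs: the a-step back from a^(k+1) already leads to a^k, so injectivity
    -- forces the step forward.
    F-a^ : ∀ k → F (a^ k) ≡ a^ k · c × F (a^ (suc k)) ≡ a^ (suc k) · c
    F-a^ zero = sym (·-identityˡ c) , F-a-e
    F-a^ (suc k) with F-a^ k
    ... | F-a^k , F-a^k+1 = F-a^k+1 , next (F-a (a^ (suc k)))
      where
      next : F (a · a^ (suc k)) ≡ a · F (a^ (suc k)) ⊎ F (a · a^ (suc k)) ≡ a⁻¹ · F (a^ (suc k)) →
             F (a^ (suc (suc k))) ≡ a^ (suc (suc k)) · c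
      next (inj₁ forward) = begin
        F (a^ (suc (suc k)))        ≡⟨ cong F (a^-+ 1 (suc k)) ⟨
        F (a · a^ (suc k))          ≡⟨ forward ⟩
        a · F (a^ (suc k))          ≡⟨ cong (a ·_) F-a^k+1 ⟩
        a · (a^ (suc k) · c)        ≡⟨ ·-assoc a (a^ (suc k)) c ⟨
        (a · a^ (suc k)) · c        ≡⟨ cong (_· c) (a^-+ 1 (suc k)) ⟩
        a^ (suc (suc k)) · c        ∎
      next (inj₂ backward) = ⊥-elim (a·a≢e (∙-cancelʳ (a^ k) (a · a) e (begin
        (a · a) · a^ k              ≡⟨ ·-assoc a a (a^ k) ⟩
        a · (a · a^ k)              ≡⟨ cong (a ·_) (a^-+ 1 k) ⟩
        a · a^ (suc k)              ≡⟨ F-injective revisit ⟩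
        a^ k                        ≡⟨ ·-identityˡ (a^ k) ⟨
        e · a^ k                    ∎)))
        where
        revisit : F (a · a^ (suc k)) ≡ F (a^ k)
        revisit = begin
          F (a · a^ (suc k))        ≡⟨ backward ⟩
          a⁻¹ · F (a^ (suc k))      ≡⟨ cong (a⁻¹ ·_) F-a^k+1 ⟩
          a⁻¹ · (a^ (suc k) · c)    ≡⟨ ·-assoc a⁻¹ (a^ (suc k)) c ⟨
          (a⁻¹ · a^ (suc k)) · c    ≡⟨ cong (λ z → (a⁻¹ · z) · c) (a^-+ 1 k) ⟨
          (a⁻¹ · (a · a^ k)) · c    ≡⟨ cong (_· c) (·-cancel-inverse a⁻¹ a a⁻¹·a≡e (a^ k)) ⟩
          a^ k · c                  ≡⟨ F-a^k ⟨
          F (a^ k)                  ∎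

    F-is-right-translation : ∀ x → F x ≡ x · c
    F-is-right-translation (i , false) = subst (λ z → F z ≡ z · c) (sym (rotation≡a^ i)) (proj₁ (F-a^ (toℕ i)))
    F-is-right-translation (i , true) = subst (λ z → F z ≡ z · c) (sym (reflection≡b·rotation i)) (begin
      F (b · r)        ≡⟨ F-b r ⟩
      b · F r          ≡⟨ cong (b ·_) (F-is-right-translation r) ⟩
      b · (r · c)      ≡⟨ ·-assoc b r c ⟨
      (b · r) · c      ∎)
      where
      r : D
      r = -ₙ i , false

  a-neighbour : ∀ x → Adj S x (a · x)
  a-neighbour x = a , inj₁ refl , refl

  a⁻¹-neighbour : ∀ x → Adj S x (a⁻¹ · x)
  a⁻¹-neighbour x = a⁻¹ , inj₂ (inj₁ refl) , refl

  b-neighbour : ∀ x → Adj S x (b · x)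
  b-neighbour x = b , inj₂ (inj₂ refl) , refl

  neighbour-cases : ∀ {x y} → Adj S x y → y ≡ a · x ⊎ y ≡ a⁻¹ · x ⊎ y ≡ b · x
  neighbour-cases (_ , inj₁ refl , y≡a·x) = inj₁ y≡a·x
  neighbour-cases (_ , inj₂ (inj₁ refl) , y≡a⁻¹·x) = inj₂ (inj₁ y≡a⁻¹·x)
  neighbour-cases (_ , inj₂ (inj₂ refl) , y≡b·x) = inj₂ (inj₂ y≡b·x)

  SecondCommonNeighbour : D → D → D → Set
  SecondCommonNeighbour x y z = Σ D λ w → Adj S y w × Adj S z w × w ≢ x

  a-b-square : ∀ x → SecondCommonNeighbour x (a · x) (b · x)
  a-b-square x = b · (a · x) , b-neighbour (a · x) , (a⁻¹ , inj₂ (inj₁ refl) , b·a·x≡a⁻¹·b·x) ,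
    λ eq → reflection≢e (·-fixes⇒≡e (b · a) x (trans (·-assoc b a x) eq))
    where
    b·a·x≡a⁻¹·b·x : b · (a · x) ≡ a⁻¹ · (b · x)
    b·a·x≡a⁻¹·b·x = trans (sym (·-assoc b a x)) (trans (cong (_· x) b·a≡a⁻¹·b) (·-assoc a⁻¹ b x))

  a⁻¹-b-square : ∀ x → SecondCommonNeighbour x (a⁻¹ · x) (b · x)
  a⁻¹-b-square x = b · (a⁻¹ · x) , b-neighbour (a⁻¹ · x) , (a , inj₁ refl , b·a⁻¹·x≡a·b·x) ,
    λ eq → reflection≢e (·-fixes⇒≡e (b · a⁻¹) x (trans (·-assoc b a⁻¹ x) eq))
    where
    b·a⁻¹·x≡a·b·x : b · (a⁻¹ · x) ≡ a · (b · x)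
    b·a⁻¹·x≡a·b·x = trans (sym (·-assoc b a⁻¹ x)) (trans (cong (_· x) b·a⁻¹≡a·b) (·-assoc a b x))

  -- Apart from x, a common neighbour of a·x and a⁻¹·x would need a²·x ≡ a⁻²·x; this is where
  -- n > 4 enters.
  a-a⁻¹-no-square : ∀ x → ¬ SecondCommonNeighbour x (a · x) (a⁻¹ · x)
  a-a⁻¹-no-square x (w , p , q , w≢x) with neighbour-cases p | neighbour-cases q
  ... | inj₂ (inj₁ w≡a⁻¹·a·x) | _ = w≢x (trans w≡a⁻¹·a·x (·-cancel-inverse a⁻¹ a a⁻¹·a≡e x))
  ... | _ | inj₁ w≡a·a⁻¹·x = w≢x (trans w≡a·a⁻¹·x (·-cancel-inverse a a⁻¹ a·a⁻¹≡e x))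
  ... | inj₁ r | inj₂ (inj₁ s) = a⁴≢e (begin
        (a · a) · (a · a)       ≡⟨ cong (_· (a · a)) (·-cancel-twoʳ a a a⁻¹ a⁻¹ x (trans (sym r) s)) ⟩
        (a⁻¹ · a⁻¹) · (a · a)   ≡⟨ ·-assoc a⁻¹ a⁻¹ (a · a) ⟩
        a⁻¹ · (a⁻¹ · (a · a))   ≡⟨ cong (a⁻¹ ·_) (·-cancel-inverse a⁻¹ a a⁻¹·a≡e a) ⟩
        a⁻¹ · a                 ≡⟨ a⁻¹·a≡e ⟩
        e                       ∎)
  ... | inj₁ r | inj₂ (inj₂ s) with () ← ·-cancel-twoʳ a a b a⁻¹ x (trans (sym r) s)
  ... | inj₂ (inj₂ r) | inj₂ (inj₁ s) with () ← ·-cancel-twoʳ b a a⁻¹ a⁻¹ x (trans (sym r) s)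
  ... | inj₂ (inj₂ r) | inj₂ (inj₂ s) =
        a≢a⁻¹ (∙-cancelˡ b a a⁻¹ (·-cancel-twoʳ b a b a⁻¹ x (trans (sym r) s)))

  swap-neighbours : ∀ {x y z} → SecondCommonNeighbour x y z → SecondCommonNeighbour x z y
  swap-neighbours (w , p , q , w≢x) = w , q , p , w≢x

  pair-without-square : ∀ {x y z} → Adj S x y → Adj S x z → y ≢ z → ¬ SecondCommonNeighbour x y z →
    (y ≡ a · x × z ≡ a⁻¹ · x) ⊎ (y ≡ a⁻¹ · x × z ≡ a · x)
  pair-without-square {x} p q y≢z no-square with neighbour-cases p | neighbour-cases q
  ... | inj₁ refl        | inj₁ refl        = ⊥-elim (y≢z refl)
  ... | inj₁ refl        | inj₂ (inj₁ refl) = inj₁ (refl , refl)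
  ... | inj₁ refl        | inj₂ (inj₂ refl) = ⊥-elim (no-square (a-b-square x))
  ... | inj₂ (inj₁ refl) | inj₁ refl        = inj₂ (refl , refl)
  ... | inj₂ (inj₁ refl) | inj₂ (inj₁ refl) = ⊥-elim (y≢z refl)
  ... | inj₂ (inj₁ refl) | inj₂ (inj₂ refl) = ⊥-elim (no-square (a⁻¹-b-square x))
  ... | inj₂ (inj₂ refl) | inj₁ refl        = ⊥-elim (no-square (swap-neighbours (a-b-square x)))
  ... | inj₂ (inj₂ refl) | inj₂ (inj₁ refl) = ⊥-elim (no-square (swap-neighbours (a⁻¹-b-square x)))
  ... | inj₂ (inj₂ refl) | inj₂ (inj₂ refl) = ⊥-elim (y≢z refl)

  third-neighbour : ∀ {x y} → Adj S x y → y ≢ a · x → y ≢ a⁻¹ · x → y ≡ b · x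
  third-neighbour p y≢a·x y≢a⁻¹·x with neighbour-cases p
  ... | inj₁ y≡a·x = ⊥-elim (y≢a·x y≡a·x)
  ... | inj₂ (inj₁ y≡a⁻¹·x) = ⊥-elim (y≢a⁻¹·x y≡a⁻¹·x)
  ... | inj₂ (inj₂ y≡b·x) = y≡b·x

  module Automorphism (φ : D ↔ D) (φ-aut : IsGraphAut S φ) where
    open Inverse φ using () renaming (to to f; from to f⁻¹; strictlyInverseˡ to f∘f⁻¹)

    f-injective : ∀ {x y} → f x ≡ f y → x ≡ y
    f-injective = Injection.injective (↔⇒↣ φ)

    f-adj : ∀ {x y} → Adj S x y → Adj S (f x) (f y)
    f-adj {x} {y} = proj₁ (φ-aut x y)

    f-adj⁻ : ∀ {x y} → Adj S (f x) (f y) → Adj S x y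
    f-adj⁻ {x} {y} = proj₂ (φ-aut x y)

    f-reflects-square : ∀ {x y z} → SecondCommonNeighbour (f x) (f y) (f z) → SecondCommonNeighbour x y z
    f-reflects-square {x} {y} {z} (w , p , q , w≢fx) =
      f⁻¹ w ,
      f-adj⁻ (subst (Adj S (f y)) (sym (f∘f⁻¹ w)) p) ,
      f-adj⁻ (subst (Adj S (f z)) (sym (f∘f⁻¹ w)) q) ,
      λ f⁻¹w≡x → w≢fx (trans (sym (f∘f⁻¹ w)) (cong f f⁻¹w≡x))

    f-a : ∀ x → (f (a · x) ≡ a · f x × f (a⁻¹ · x) ≡ a⁻¹ · f x)
              ⊎ (f (a · x) ≡ a⁻¹ · f x × f (a⁻¹ · x) ≡ a · f x)
    f-a x = pair-without-square (f-adj (a-neighbour x)) (f-adj (a⁻¹-neighbour x))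
      (λ eq → a≢a⁻¹ (∙-cancelʳ x a a⁻¹ (f-injective eq)))
      (λ square → a-a⁻¹-no-square x (f-reflects-square square))

    f[b·x]≢f[s·x] : ∀ {s} x → s ≢ b → f (b · x) ≢ f (s · x)
    f[b·x]≢f[s·x] {s} x s≢b eq = s≢b (sym (∙-cancelʳ x b s (f-injective eq)))

    f-b : ∀ x → f (b · x) ≡ b · f x
    f-b x with f-a x
    ... | inj₁ (fa , fa⁻¹) = third-neighbour (f-adj (b-neighbour x))
      (λ eq → f[b·x]≢f[s·x] {a} x (λ ()) (trans eq (sym fa)))
      (λ eq → f[b·x]≢f[s·x] {a⁻¹} x (λ ()) (trans eq (sym fa⁻¹)))
    ... | inj₂ (fa , fa⁻¹) = third-neighbour (f-adj (b-neighbour x))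
      (λ eq → f[b·x]≢f[s·x] {a⁻¹} x (λ ()) (trans eq (sym fa⁻¹)))
      (λ eq → f[b·x]≢f[s·x] {a} x (λ ()) (trans eq (sym fa)))

    f-a-direction : ∀ x → f (a · x) ≡ a · f x ⊎ f (a · x) ≡ a⁻¹ · f x
    f-a-direction x = Sum.map proj₁ proj₁ (f-a x)

    f-affine : (∀ y → f y ≡ y · f e) ⊎ (∀ y → f y ≡ σ y · f e)
    f-affine with f-a e
    ... | inj₁ (fa , _) = inj₁ (F-is-right-translation f f-injective f-b f-a-direction
                                  (trans (cong f (sym (·-identityʳ a))) fa))
    ... | inj₂ (_ , fa⁻¹) = inj₂ λ y → begin
          f y                ≡⟨ cong f (σ-involutive y) ⟨
          F (σ y)            ≡⟨ F-is-right-translation F F-injective F-b F-a-direction F-a-e (σ y) ⟩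
          σ y · F e          ≡⟨ cong (λ z → σ y · f z) σ-e ⟩
          σ y · f e          ∎
      where
      F : D → D
      F = f ∘ σ
      F-injective : ∀ {x y} → F x ≡ F y → x ≡ y
      F-injective {x} {y} eq = trans (sym (σ-involutive x)) (trans (cong σ (f-injective eq)) (σ-involutive y))
      F-b : ∀ x → F (b · x) ≡ b · F x
      F-b x = trans (cong f (trans (σ-homo b x) (cong (_· σ x) σ-b))) (f-b (σ x))
      F-a-direction : ∀ x → F (a · x) ≡ a · F x ⊎ F (a · x) ≡ a⁻¹ · F x
      F-a-direction x = Sum.map (trans F[a·x]≡f[a⁻¹·σx] ∘ proj₂) (trans F[a·x]≡f[a⁻¹·σx] ∘ proj₂) (Sum.swap (f-a (σ x)))
        where
        F[a·x]≡f[a⁻¹·σx] : F (a · x) ≡ f (a⁻¹ · σ x)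
        F[a·x]≡f[a⁻¹·σx] = cong f (trans (σ-homo a x) (cong (_· σ x) σ-a))
      F-a-e : F a ≡ a · F e
      F-a-e = begin
        f (σ a)            ≡⟨ cong f (trans σ-a (sym (·-identityʳ a⁻¹))) ⟩
        f (a⁻¹ · e)        ≡⟨ fa⁻¹ ⟩
        a · f e            ≡⟨ cong (λ z → a · f z) σ-e ⟨
        a · F e            ∎

  S-isNormal : IsNormalCayley S
  S-isNormal φ φ-aut with Automorphism.f-affine φ φ-aut
  ... | inj₁ f≡R[fe] = affine-normalises-R φ id (λ _ _ → refl) _ f≡R[fe]
  ... | inj₂ f≡σ·fe = affine-normalises-R φ σ σ-homo _ f≡σ·fe

  α[a]²≢e : (α : D ↔ D) → IsGroupAut α → Inverse.to α a · Inverse.to α a ≢ e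
  α[a]²≢e α α-homo α[a]²≡e = a·a≢e (Injection.injective (↔⇒↣ α) (begin
    α⟨ a · a ⟩               ≡⟨ α-homo a a ⟩
    α⟨ a ⟩ · α⟨ a ⟩          ≡⟨ α[a]²≡e ⟩
    e                        ≡⟨ groupAut-e α α-homo ⟨
    α⟨ e ⟩                   ∎))
    where
    α⟨_⟩ : D → D
    α⟨_⟩ = Inverse.to α

  S-notCI : 2 ∣ n → ¬ IsCIGraph S
  S-notCI 2∣n isCI =
    let open ParityTwist n 2∣n
        (α , α-homo , α[S]⊆T , _) = isCI T e∉T S≅T
    in α[a]²≢e α α-homo (T-involutive _ (α[S]⊆T a (inj₁ refl)))

lemma4p2 : (n : ℕ) .{{_ : NonZero n}} → 4 < n → 2 ∣ n →
    Dihedral.IsNormalCayley n (Dihedral.S n) × ¬ Dihedral.IsCIGraph n (Dihedral.S n)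
lemma4p2 n 4<n 2∣n = S-isNormal , S-notCI 2∣n
  where open PrismGraph n 4<n
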